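{- The relation $\prec$ on RMTL formulas is a well-founded partial order.
   Context: RMTL formulas: $\bot$, undefined atoms $p(\vec t)$, defined atoms $P(\vec t)$, $\phi\lor\psi$, $\neg\phi$, $\bullet\phi$ (previous), $\phi\mathbb{S}\psi$ (since), $\mathsf{O}\phi$ (once), $\mathsf{O}^{<}\phi$ (strictly once: some strictly earlier world), metric versions $\bullet_n\phi$, $\phi\mathbb{S}_n\psi$, $\mathsf{O}_n\phi$, $\mathsf{O}^{<}_n\phi$, and $\exists_\alpha x.\phi$. Each defined predicate $P$ has a definition $P(\vec x):=\phi_P(\vec x)$ that is guarded: every occurrence of a defined predicate in $\phi_P$ is prefixed by $\bullet$, $\bullet_m$, $\mathsf{O}^{<}$ or $\mathsf{O}^{<}_n$. The relation $\prec_S$ is the smallest relation such that: (1) formulas of the form $p(\vec t)$, $\bot$, $\bullet\psi$, $\bullet_n\psi$, $\mathsf{O}^{<}\psi$, $\mathsf{O}^{<}_n\psi$ have no $\prec_S$-predecessor; (2) $\phi_P(\vec t)\prec_S P(\vec t)$ for every definition $P(\vec x):=\phi_P(\vec x)$ and terms $\vec t$; (3) $\psi\prec_S\psi\lor\psi'$, $\psi\prec_S\psi'\lor\psi$, $\psi\prec_S\neg\psi$, $\psi\prec_S\exists x.\psi$; (4) $\psi_i\prec_S\psi_1\mathbb{S}\psi_2$ and $\psi_i\prec_S\psi_1\mathbb{S}_n\psi_2$ for $i\in\{1,2\}$. $\prec$ is the reflexive-transitive closure of $\prec_S$. -}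

module Defs where

open import Data.Nat using (ℕ)
open import Data.Vec using (Vec)
open import Data.Unit using (⊤)
open import Data.Empty using (⊥)
open import Data.Product using (_×_)
open import Relation.Binary.PropositionalEquality using (_≡_)
open import Relation.Binary.Construct.Closure.ReflexiveTransitive using (Star)
import Relation.Binary.Construct.NonStrictToStrict as NS

-- A signature for RMTL: variables, terms, sorts (the α in ∃_α x),
-- undefined predicate symbols p and defined predicate symbols P, with arities.
record Signature : Set₁ where
  field
    Var   : Set
    Term  : Set
    Sort  : Set
    UPred : Set
    uarity : UPred → ℕ
    DPred : Set
    darity : DPred → ℕ

module RMTL (Sig : Signature) where
  open Signature Sig

  infixr 5 _∨_

  data Formula : Set where
    ⊥f    : Formula
    patom : (p : UPred) → Vec Term (uarity p) → Formula
    Patom : (P : DPred) → Vec Term (darity P) → Formula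
    _∨_   : Formula → Formula → Formula
    ¬f    : Formula → Formula
    prev  : Formula → Formula
    since : Formula → Formula → Formula
    once  : Formula → Formula
    once< : Formula → Formula
    prevₙ  : ℕ → Formula → Formula
    sinceₙ : ℕ → Formula → Formula → Formula
    onceₙ  : ℕ → Formula → Formula
    once<ₙ : ℕ → Formula → Formula
    ∃f    : Sort → Var → Formula → Formula

  Guarded : Formula → Set
  Guarded ⊥f = ⊤
  Guarded (patom p ts) = ⊤
  Guarded (Patom P ts) = ⊥
  Guarded (φ ∨ ψ) = Guarded φ × Guarded ψ
  Guarded (¬f φ) = Guarded φ
  Guarded (prev φ) = ⊤
  Guarded (since φ ψ) = Guarded φ × Guarded ψ
  Guarded (once φ) = Guarded φ
  Guarded (once< φ) = ⊤
  Guarded (prevₙ n φ) = ⊤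
  Guarded (sinceₙ n φ ψ) = Guarded φ × Guarded ψ
  Guarded (onceₙ n φ) = Guarded φ
  Guarded (once<ₙ n φ) = ⊤
  Guarded (∃f α x φ) = Guarded φ

  -- A family of guarded definitions P(x⃗) := φ_P(x⃗).
  -- body P t⃗ is the instance φ_P(t⃗) of the definition body at terms t⃗.
  record Definitions : Set where
    field
      body    : (P : DPred) → Vec Term (darity P) → Formula
      guarded : (P : DPred) (ts : Vec Term (darity P)) → Guarded (body P ts)

  module _ (D : Definitions) where
    open Definitions D

    data _≺S_ : Formula → Formula → Set where
      unfold : ∀ P ts → body P ts ≺S Patom P ts
      ∨ˡ     : ∀ ψ ψ′ → ψ ≺S (ψ ∨ ψ′)
      ∨ʳ     : ∀ ψ ψ′ → ψ ≺S (ψ′ ∨ ψ)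
      ¬≺     : ∀ ψ → ψ ≺S ¬f ψ
      ∃≺     : ∀ α x ψ → ψ ≺S ∃f α x ψ
      S₁     : ∀ ψ₁ ψ₂ → ψ₁ ≺S since ψ₁ ψ₂
      S₂     : ∀ ψ₁ ψ₂ → ψ₂ ≺S since ψ₁ ψ₂
      Sₙ₁    : ∀ n ψ₁ ψ₂ → ψ₁ ≺S sinceₙ n ψ₁ ψ₂
      Sₙ₂    : ∀ n ψ₁ ψ₂ → ψ₂ ≺S sinceₙ n ψ₁ ψ₂

    _≺_ : Formula → Formula → Set
    _≺_ = Star _≺S_

    _≺⁺_ : Formula → Formula → Set
    _≺⁺_ = NS._<_ _≡_ _≺_

module Submission where

-- The proof is a rank argument.
--
-- 1. A general fact: if every step of a relation R strictly increases a
--    natural-number rank, then the reflexive-transitive closure R* is a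
--    partial order (w.r.t. ≡) whose strict part is well-founded, since a
--    strict R*-step also strictly increases the rank.
-- 2. For RMTL we rank formulas by their syntactic height, where ⊥, p(t⃗)
--    and all formulas headed by •, O, O^< (and their metric versions) have
--    height 0, and the height of a defined atom is given by a weight.
--    Heights of guarded formulas do not depend on the weights at all,
--    because defined atoms only occur below height-0 operators.
-- 3. Choosing the weight of P(t⃗) to be one more than the height of its
--    guarded body φ_P(t⃗) makes every ≺_S-step strictly increase the rank,
--    and the theorem follows from step 1.

open import Defs
open import Data.Product using (_×_; _,_)
open import Data.Nat using (ℕ; suc; _⊔_; _<_; _≤_; s≤s)
open import Data.Nat.Properties
  using (m≤m⊔n; m≤n⊔m; ≤-refl; ≤-trans; <⇒≤; <-≤-trans; <-irrefl)
open import Data.Nat.Induction using (<-wellFounded)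
open import Data.Vec using (Vec)
open import Data.Empty using (⊥-elim)
open import Level using (Level)
open import Relation.Nullary using (¬_)
open import Relation.Binary.Core using (Rel)
open import Relation.Binary.PropositionalEquality
  using (_≡_; refl; cong; cong₂; isEquivalence)
open import Relation.Binary.Structures using (IsPartialOrder)
open import Relation.Binary.Construct.Closure.ReflexiveTransitive
  using (Star; ε; _◅_; _◅◅_)
import Relation.Binary.Construct.NonStrictToStrict as NS
import Relation.Binary.Construct.On as On
open import Induction.WellFounded using (WellFounded; module Subrelation)

module RankedClosure {a ℓ : Level} {A : Set a} {R : Rel A ℓ}
                     (rank : A → ℕ)
                     (rank-step : ∀ {x y} → R x y → rank x < rank y) where

  rank-mono : ∀ {x y} → Star R x y → rank x ≤ rank y
  rank-mono ε       = ≤-refl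
  rank-mono (s ◅ p) = ≤-trans (<⇒≤ (rank-step s)) (rank-mono p)

  rank-strict : ∀ {x y} → Star R x y → ¬ x ≡ y → rank x < rank y
  rank-strict ε       x≢x = ⊥-elim (x≢x refl)
  rank-strict (s ◅ p) _   = <-≤-trans (rank-step s) (rank-mono p)

  -- Two opposite paths must both be empty, since a non-empty one would
  -- make the rank strictly increase around a cycle.
  antisym : ∀ {x y} → Star R x y → Star R y x → x ≡ y
  antisym ε       _ = refl
  antisym (s ◅ p) q = ⊥-elim (<-irrefl refl
    (<-≤-trans (<-≤-trans (rank-step s) (rank-mono p)) (rank-mono q)))

  isPartialOrder : IsPartialOrder _≡_ (Star R)
  isPartialOrder = record
    { isPreorder = record
      { isEquivalence = isEquivalence
      ; reflexive     = λ { refl → ε }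
      ; trans         = _◅◅_
      }
    ; antisym = antisym
    }

  wellFounded : WellFounded (NS._<_ _≡_ (Star R))
  wellFounded = Subrelation.wellFounded (λ { (p , x≢y) → rank-strict p x≢y })
                                        (On.wellFounded rank <-wellFounded)

module Heights (Sig : Signature) where
  open Signature Sig
  open RMTL Sig

  Weight : Set
  Weight = (P : DPred) → Vec Term (darity P) → ℕ

  height : Weight → Formula → ℕ
  height w ⊥f             = 0
  height w (patom p ts)   = 0
  height w (Patom P ts)   = w P ts
  height w (φ ∨ ψ)        = suc (height w φ ⊔ height w ψ)
  height w (¬f φ)         = suc (height w φ)
  height w (prev φ)       = 0
  height w (since φ ψ)    = suc (height w φ ⊔ height w ψ)
  height w (once φ)       = 0
  height w (once< φ)      = 0
  height w (prevₙ n φ)    = 0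
  height w (sinceₙ n φ ψ) = suc (height w φ ⊔ height w ψ)
  height w (onceₙ n φ)    = 0
  height w (once<ₙ n φ)   = 0
  height w (∃f α x φ)     = suc (height w φ)

  -- In a guarded formula no weighted atom is reached, so the height is
  -- independent of the weight.
  guarded-height : ∀ w w′ φ → Guarded φ → height w φ ≡ height w′ φ
  guarded-height w w′ ⊥f             _       = refl
  guarded-height w w′ (patom p ts)   _       = refl
  guarded-height w w′ (Patom P ts)   ()
  guarded-height w w′ (φ ∨ ψ)        (g , h) =
    cong suc (cong₂ _⊔_ (guarded-height w w′ φ g) (guarded-height w w′ ψ h))
  guarded-height w w′ (¬f φ)         g       = cong suc (guarded-height w w′ φ g)
  guarded-height w w′ (prev φ)       _       = refl
  guarded-height w w′ (since φ ψ)    (g , h) =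
    cong suc (cong₂ _⊔_ (guarded-height w w′ φ g) (guarded-height w w′ ψ h))
  guarded-height w w′ (once φ)       _       = refl
  guarded-height w w′ (once< φ)      _       = refl
  guarded-height w w′ (prevₙ n φ)    _       = refl
  guarded-height w w′ (sinceₙ n φ ψ) (g , h) =
    cong suc (cong₂ _⊔_ (guarded-height w w′ φ g) (guarded-height w w′ ψ h))
  guarded-height w w′ (onceₙ n φ)    _       = refl
  guarded-height w w′ (once<ₙ n φ)   _       = refl
  guarded-height w w′ (∃f α x φ)     g       = cong suc (guarded-height w w′ φ g)

module Rank (Sig : Signature) (D : RMTL.Definitions Sig) where
  open RMTL Sig
  open Definitions D
  open Heights Sig

  -- The rank of a formula: a defined atom weighs one more than the height of
  -- its body, which is well defined since bodies are measured with weight 0.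
  atomWeight : Weight
  atomWeight P ts = suc (height (λ _ _ → 0) (body P ts))

  rank : Formula → ℕ
  rank = height atomWeight

  -- Unfolding a defined atom: the body is guarded, so its rank is its
  -- weight-0 height, one less than the rank of the atom.
  rank-body : ∀ P ts → rank (body P ts) < rank (Patom P ts)
  rank-body P ts
    rewrite guarded-height atomWeight (λ _ _ → 0) (body P ts) (guarded P ts) = ≤-refl

  rank-step : ∀ {φ ψ} → _≺S_ D φ ψ → rank φ < rank ψ
  rank-step (unfold P ts)  = rank-body P ts
  rank-step (∨ˡ ψ ψ′)      = s≤s (m≤m⊔n (rank ψ) (rank ψ′))
  rank-step (∨ʳ ψ ψ′)      = s≤s (m≤n⊔m (rank ψ′) (rank ψ))
  rank-step (¬≺ ψ)         = ≤-refl
  rank-step (∃≺ α x ψ)     = ≤-refl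
  rank-step (S₁ ψ₁ ψ₂)     = s≤s (m≤m⊔n (rank ψ₁) (rank ψ₂))
  rank-step (S₂ ψ₁ ψ₂)     = s≤s (m≤n⊔m (rank ψ₁) (rank ψ₂))
  rank-step (Sₙ₁ n ψ₁ ψ₂)  = s≤s (m≤m⊔n (rank ψ₁) (rank ψ₂))
  rank-step (Sₙ₂ n ψ₁ ψ₂)  = s≤s (m≤n⊔m (rank ψ₁) (rank ψ₂))

lemma1 : (Sig : Signature) (D : RMTL.Definitions Sig) →
           IsPartialOrder _≡_ (RMTL._≺_ Sig D) × WellFounded (RMTL._≺⁺_ Sig D)
lemma1 Sig D = isPartialOrder , wellFounded
  where
    open Rank Sig D using (rank; rank-step)
    open RankedClosure rank (λ {φ} {ψ} → rank-step {φ} {ψ})
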